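{- Let $b\in\mathbb{N}$, $b\geq 1$, and let $v\in\{0,1\}^*$. Then $|\psi_b(v)|_{\text{pal}}\leq |v|_{\text{pal}}+1$.
   Context: For an integer $b\geq 1$, $\psi_b:\{0,1\}^*\to\{0,1\}^*$ is the morphism defined by $\psi_b(0)=10^{b-1}$ and $\psi_b(1)=10^{b}$. A palindrome is a finite word equal to its reversal (the empty word is a palindrome). The palindromic length $|v|_{\text{pal}}$ of a finite word $v$ is the minimal number $K$ of palindromes $p_1,\dots,p_K$ such that $v=p_1p_2\cdots p_K$. -}

module Defs where

open import Data.Bool using (Bool; true; false)
open import Data.List using (List; []; _∷_; _++_; reverse; replicate; concat; concatMap; length)
open import Data.List.Relation.Unary.All using (All)
open import Data.Nat using (ℕ; _≤_)
open import Data.Product using (Σ; _×_)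
open import Relation.Binary.PropositionalEquality using (_≡_)

-- Binary words: letter 0 is false, letter 1 is true.
Word : Set
Word = List Bool

ψ-letter : ℕ → Bool → Word
ψ-letter b false = true ∷ replicate (b Data.Nat.∸ 1) false
ψ-letter b true  = true ∷ replicate b false

ψ : ℕ → Word → Word
ψ b = concatMap (ψ-letter b)

IsPalindrome : Word → Set
IsPalindrome w = reverse w ≡ w

PalFactorization : Word → List Word → Set
PalFactorization v ps = All IsPalindrome ps × concat ps ≡ v

IsPalLength : Word → ℕ → Set
IsPalLength v K =
  Σ (List Word) (λ ps → PalFactorization v ps × length ps ≡ K)
  × (∀ (qs : List Word) → PalFactorization v qs → K ≤ length qs)

module Submission where

-- If p is a palindrome then ψ_b(p)·1 is a palindrome (ψ-closing), because
-- every letter image has the shape 1·0^k and 1·0^k·1 is a palindrome.  Hence for a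
-- nonempty palindrome p we can write ψ_b(p) = 1·u with u a palindrome.  Given a
-- factorization v = p₁ ⋯ p_K into palindromes, ψ_b(v) = 1u₁ 1u₂ ⋯ 1u_K, and this word
-- splits into palindromes by alternately taking a block 1u_i1 or a block u_i:
--   K even:  (1u₁1)(u₂)(1u₃1)(u₄) ⋯ (u_K)          — K pieces,
--   K odd:   (1)(u₁)(1u₂1)(u₃) ⋯ (u_K)              — K + 1 pieces.
-- Formally we prove by simultaneous induction on the factorization that ψ_b(v) has a
-- palindromic factorization with at most ⌈K⌉even parts and ψ_b(v) with its first letter
-- removed one with at most ⌈K⌉odd parts.  Since ⌈K⌉even ≤ K + 1, minimality of |ψ_b(v)|_pal
-- gives the theorem.

open import Defs
open import Data.Nat using (ℕ; zero; suc; _≤_; _+_; z≤n; s≤s)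
open import Data.Nat.Properties using (≤-trans; +-comm)
open import Data.Bool using (Bool; true; false)
open import Data.List using (List; []; _∷_; _++_; _∷ʳ_; reverse; replicate; concat; length; drop; [_])
open import Data.List.Properties
  using (reverse-++; unfold-reverse; concatMap-++; ++-identityʳ; ++-assoc; ++-cancelʳ; ∷-injectiveʳ)
open import Data.List.Relation.Unary.All using (All; []; _∷_)
open import Data.Product using (Σ; _×_; _,_; proj₁; proj₂)
open import Data.Sum using (_⊎_; inj₁; inj₂)
open import Relation.Binary.PropositionalEquality using (_≡_; refl; sym; trans; cong; subst; module ≡-Reasoning)

-- Parity ceilings: ⌈ n ⌉even and ⌈ n ⌉odd are the least even resp. odd numbers ≥ n.
mutual
  ⌈_⌉even : ℕ → ℕ
  ⌈ zero ⌉even = 0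
  ⌈ suc n ⌉even = suc ⌈ n ⌉odd

  ⌈_⌉odd : ℕ → ℕ
  ⌈ zero ⌉odd = 1
  ⌈ suc n ⌉odd = suc ⌈ n ⌉even

mutual
  ⌈⌉even≤suc : (n : ℕ) → ⌈ n ⌉even ≤ suc n
  ⌈⌉even≤suc zero = z≤n
  ⌈⌉even≤suc (suc n) = s≤s (⌈⌉odd≤suc n)

  ⌈⌉odd≤suc : (n : ℕ) → ⌈ n ⌉odd ≤ suc n
  ⌈⌉odd≤suc zero = s≤s z≤n
  ⌈⌉odd≤suc (suc n) = s≤s (⌈⌉even≤suc n)

-- Both ceilings are monotone in n (used to skip empty palindromes).
mutual
  ⌈⌉even-mono : (n : ℕ) → ⌈ n ⌉even ≤ ⌈ suc n ⌉even
  ⌈⌉even-mono zero = z≤n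
  ⌈⌉even-mono (suc n) = s≤s (⌈⌉odd-mono n)

  ⌈⌉odd-mono : (n : ℕ) → ⌈ n ⌉odd ≤ ⌈ suc n ⌉odd
  ⌈⌉odd-mono zero = s≤s z≤n
  ⌈⌉odd-mono (suc n) = s≤s (⌈⌉even-mono n)

⌈⌉odd-positive : (n : ℕ) → 1 ≤ ⌈ n ⌉odd
⌈⌉odd-positive zero = s≤s z≤n
⌈⌉odd-positive (suc n) = s≤s z≤n

reverse-replicate : {A : Set} (n : ℕ) (a : A) → reverse (replicate n a) ≡ replicate n a
reverse-replicate zero a = refl
reverse-replicate (suc n) a = begin
  reverse (a ∷ replicate n a)    ≡⟨ unfold-reverse a (replicate n a) ⟩
  reverse (replicate n a) ∷ʳ a   ≡⟨ cong (_∷ʳ a) (reverse-replicate n a) ⟩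
  replicate n a ∷ʳ a             ≡⟨ replicate-snoc n ⟩
  a ∷ replicate n a              ∎
  where
  open ≡-Reasoning
  replicate-snoc : (m : ℕ) → replicate m a ∷ʳ a ≡ a ∷ replicate m a
  replicate-snoc zero = refl
  replicate-snoc (suc m) = cong (a ∷_) (replicate-snoc m)

one-zeros-closing : (k : ℕ) →
  true ∷ reverse (true ∷ replicate k false) ≡ (true ∷ replicate k false) ∷ʳ true
one-zeros-closing k = cong (true ∷_) (begin
  reverse (true ∷ replicate k false)   ≡⟨ unfold-reverse true (replicate k false) ⟩
  reverse (replicate k false) ∷ʳ true  ≡⟨ cong (_∷ʳ true) (reverse-replicate k false) ⟩
  replicate k false ∷ʳ true            ∎)
  where open ≡-Reasoning

-- Every letter image has the shape 1·0^k.
ψ-letter-closing : (b : ℕ) (x : Bool) → true ∷ reverse (ψ-letter b x) ≡ ψ-letter b x ∷ʳ true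
ψ-letter-closing b false = one-zeros-closing _
ψ-letter-closing b true = one-zeros-closing b

ψ-++ : (b : ℕ) (u w : Word) → ψ b (u ++ w) ≡ ψ b u ++ ψ b w
ψ-++ b = concatMap-++ (ψ-letter b)

ψ-reverse : (b : ℕ) (w : Word) → true ∷ reverse (ψ b w) ≡ ψ b (reverse w) ∷ʳ true
ψ-reverse b [] = refl
ψ-reverse b (x ∷ w) = begin
  true ∷ reverse (ψ-letter b x ++ ψ b w)             ≡⟨ cong (true ∷_) (reverse-++ (ψ-letter b x) (ψ b w)) ⟩
  (true ∷ reverse (ψ b w)) ++ reverse (ψ-letter b x) ≡⟨ cong (_++ reverse (ψ-letter b x)) (ψ-reverse b w) ⟩
  (ψ b (reverse w) ∷ʳ true) ++ reverse (ψ-letter b x) ≡⟨ ++-assoc (ψ b (reverse w)) [ true ] _ ⟩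
  ψ b (reverse w) ++ (true ∷ reverse (ψ-letter b x)) ≡⟨ cong (ψ b (reverse w) ++_) (ψ-letter-closing b x) ⟩
  ψ b (reverse w) ++ (ψ-letter b x ∷ʳ true)          ≡⟨ sym (++-assoc (ψ b (reverse w)) _ _) ⟩
  (ψ b (reverse w) ++ ψ-letter b x) ∷ʳ true          ≡⟨ cong (λ t → (ψ b (reverse w) ++ t) ∷ʳ true) (sym (++-identityʳ (ψ-letter b x))) ⟩
  (ψ b (reverse w) ++ ψ b [ x ]) ∷ʳ true             ≡⟨ cong (_∷ʳ true) (sym (ψ-++ b (reverse w) [ x ])) ⟩
  ψ b (reverse w ∷ʳ x) ∷ʳ true                       ≡⟨ cong (λ t → ψ b t ∷ʳ true) (sym (unfold-reverse x w)) ⟩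
  ψ b (reverse (x ∷ w)) ∷ʳ true                      ∎
  where open ≡-Reasoning

ψ-closing : (b : ℕ) {p : Word} → IsPalindrome p → IsPalindrome (ψ b p ∷ʳ true)
ψ-closing b {p} pal = begin
  reverse (ψ b p ∷ʳ true)   ≡⟨ reverse-++ (ψ b p) [ true ] ⟩
  true ∷ reverse (ψ b p)    ≡⟨ ψ-reverse b p ⟩
  ψ b (reverse p) ∷ʳ true   ≡⟨ cong (λ t → ψ b t ∷ʳ true) pal ⟩
  ψ b p ∷ʳ true             ∎
  where open ≡-Reasoning

ψ-nonempty : (b : ℕ) (x : Bool) (w : Word) → ψ b (x ∷ w) ≡ true ∷ drop 1 (ψ b (x ∷ w))
ψ-nonempty b false w = refl
ψ-nonempty b true w = refl

ψ-head : (b : ℕ) (w : Word) → ψ b w ≡ [] ⊎ ψ b w ≡ true ∷ drop 1 (ψ b w)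
ψ-head b [] = inj₁ refl
ψ-head b (x ∷ w) = inj₂ (ψ-nonempty b x w)

unwrap-palindrome : (u : Word) → IsPalindrome (true ∷ u ∷ʳ true) → IsPalindrome u
unwrap-palindrome u pal = ++-cancelʳ [ true ] (reverse u) u (∷-injectiveʳ (begin
  true ∷ (reverse u ∷ʳ true)        ≡⟨ cong (true ∷_) (sym (unfold-reverse true u)) ⟩
  true ∷ reverse (true ∷ u)         ≡⟨ sym (reverse-++ (true ∷ u) [ true ]) ⟩
  reverse ((true ∷ u) ∷ʳ true)      ≡⟨ pal ⟩
  true ∷ (u ∷ʳ true)                ∎))
  where open ≡-Reasoning

ψ-tail-palindrome : (b : ℕ) (x : Bool) (p : Word) →
  IsPalindrome (x ∷ p) → IsPalindrome (drop 1 (ψ b (x ∷ p)))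
ψ-tail-palindrome b x p pal =
  unwrap-palindrome _ (subst (λ t → IsPalindrome (t ∷ʳ true)) (ψ-nonempty b x p) (ψ-closing b pal))

Factorizable : Word → ℕ → Set
Factorizable w n = Σ (List Word) (λ qs → PalFactorization w qs × length qs ≤ n)

factorizable-[] : Factorizable [] 0
factorizable-[] = [] , ([] , refl) , z≤n

factorizable-∷ : {p w : Word} {n : ℕ} → IsPalindrome p → Factorizable w n → Factorizable (p ++ w) (suc n)
factorizable-∷ {p} pal (qs , (pals , eq) , len) = p ∷ qs , (pal ∷ pals , cong (p ++_) eq) , s≤s len

factorizable-weaken : {w : Word} {m n : ℕ} → m ≤ n → Factorizable w m → Factorizable w n
factorizable-weaken m≤n (qs , fact , len) = qs , fact , ≤-trans len m≤n

factorizable-≡ : {w w′ : Word} {n : ℕ} → w ≡ w′ → Factorizable w n → Factorizable w′ n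
factorizable-≡ {n = n} = subst (λ t → Factorizable t n)

mutual
  ψ-factorizable : (b : ℕ) (ps : List Word) → All IsPalindrome ps →
    Factorizable (ψ b (concat ps)) ⌈ length ps ⌉even
  ψ-factorizable b [] [] = factorizable-[]
  ψ-factorizable b ([] ∷ ps) (_ ∷ pals) =
    factorizable-weaken (⌈⌉even-mono (length ps)) (ψ-factorizable b ps pals)
  ψ-factorizable b ((x ∷ p) ∷ ps) (pal ∷ pals) with ψ-head b (concat ps)
  -- ψ_b(p) = 1·u is the last image: split it as (1)(u).
  ... | inj₁ rest≡[] =
    factorizable-weaken (s≤s (⌈⌉odd-positive (length ps)))
      (factorizable-≡ word (factorizable-∷ {p = [ true ]} refl (factorizable-∷ (ψ-tail-palindrome b x p pal) factorizable-[])))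
    where
    word : [ true ] ++ (drop 1 (ψ b (x ∷ p)) ++ []) ≡ ψ b (concat ((x ∷ p) ∷ ps))
    word = begin
      true ∷ (drop 1 (ψ b (x ∷ p)) ++ [])   ≡⟨ cong (true ∷_) (++-identityʳ _) ⟩
      true ∷ drop 1 (ψ b (x ∷ p))           ≡⟨ sym (ψ-nonempty b x p) ⟩
      ψ b (x ∷ p)                           ≡⟨ sym (++-identityʳ _) ⟩
      ψ b (x ∷ p) ++ []                     ≡⟨ cong (ψ b (x ∷ p) ++_) (sym rest≡[]) ⟩
      ψ b (x ∷ p) ++ ψ b (concat ps)        ≡⟨ sym (ψ-++ b (x ∷ p) (concat ps)) ⟩
      ψ b (concat ((x ∷ p) ∷ ps))           ∎
      where open ≡-Reasoning
  -- The next image starts with 1: take the block ψ_b(p)·1 and continue with the tail.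
  ... | inj₂ rest≡1∷tail =
    factorizable-≡ word (factorizable-∷ (ψ-closing b pal) (tail-factorizable b ps pals))
    where
    word : (ψ b (x ∷ p) ∷ʳ true) ++ drop 1 (ψ b (concat ps)) ≡ ψ b (concat ((x ∷ p) ∷ ps))
    word = begin
      (ψ b (x ∷ p) ∷ʳ true) ++ drop 1 (ψ b (concat ps))   ≡⟨ ++-assoc (ψ b (x ∷ p)) [ true ] _ ⟩
      ψ b (x ∷ p) ++ (true ∷ drop 1 (ψ b (concat ps)))    ≡⟨ cong (ψ b (x ∷ p) ++_) (sym rest≡1∷tail) ⟩
      ψ b (x ∷ p) ++ ψ b (concat ps)                      ≡⟨ sym (ψ-++ b (x ∷ p) (concat ps)) ⟩
      ψ b (concat ((x ∷ p) ∷ ps))                         ∎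
      where open ≡-Reasoning

  tail-factorizable : (b : ℕ) (ps : List Word) → All IsPalindrome ps →
    Factorizable (drop 1 (ψ b (concat ps))) ⌈ length ps ⌉odd
  tail-factorizable b [] [] = factorizable-weaken z≤n factorizable-[]
  tail-factorizable b ([] ∷ ps) (_ ∷ pals) =
    factorizable-weaken (⌈⌉odd-mono (length ps)) (tail-factorizable b ps pals)
  -- Removing the leading 1 of ψ_b(p) = 1·u leaves the palindrome u, then the next images.
  tail-factorizable b ((x ∷ p) ∷ ps) (pal ∷ pals) =
    factorizable-≡ word (factorizable-∷ (ψ-tail-palindrome b x p pal) (ψ-factorizable b ps pals))
    where
    word : drop 1 (ψ b (x ∷ p)) ++ ψ b (concat ps) ≡ drop 1 (ψ b (concat ((x ∷ p) ∷ ps)))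
    word = begin
      drop 1 (ψ b (x ∷ p)) ++ ψ b (concat ps)           ≡⟨⟩
      drop 1 ((true ∷ drop 1 (ψ b (x ∷ p))) ++ ψ b (concat ps))
        ≡⟨ cong (λ t → drop 1 (t ++ ψ b (concat ps))) (sym (ψ-nonempty b x p)) ⟩
      drop 1 (ψ b (x ∷ p) ++ ψ b (concat ps))           ≡⟨ cong (drop 1) (sym (ψ-++ b (x ∷ p) (concat ps))) ⟩
      drop 1 (ψ b (concat ((x ∷ p) ∷ ps)))              ∎
      where open ≡-Reasoning

lemma8 : (b : ℕ) → 1 ≤ b → (v : Word) → (K M : ℕ) →
    IsPalLength v K → IsPalLength (ψ b v) M → M ≤ K + 1
lemma8 b _ v K M ((ps , (pals , concat≡v) , length≡K) , _) (_ , M-minimal) =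
  subst (M ≤_) (+-comm 1 K) (≤-trans (M-minimal qs (qpals , image≡)) (≤-trans qlen bound))
  where
  factorization : Factorizable (ψ b (concat ps)) ⌈ length ps ⌉even
  factorization = ψ-factorizable b ps pals
  qs : List Word
  qs = proj₁ factorization
  qpals : All IsPalindrome qs
  qpals = proj₁ (proj₁ (proj₂ factorization))
  image≡ : concat qs ≡ ψ b v
  image≡ = trans (proj₂ (proj₁ (proj₂ factorization))) (cong (ψ b) concat≡v)
  qlen : length qs ≤ ⌈ length ps ⌉even
  qlen = proj₂ (proj₂ factorization)
  bound : ⌈ length ps ⌉even ≤ suc K
  bound = subst (λ k → ⌈ length ps ⌉even ≤ suc k) length≡K (⌈⌉even≤suc (length ps))
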